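{- Let $H$ be a graph on $m$ vertices, regarded as a subgraph of $K_n$ on $m$ of its $n$ vertices. If there exists a $(v,k,1)$-design with $k\geq m$ and $v-k\geq n-m$, then \[\operatorname{scp}(K_n-H)\leq \frac{n(v-1)}{k-1}+\operatorname{scp}(\overline{H})-m.\]
   Context: A $(v,k,\lambda)$-design is a pair $(P,\mathcal{B})$ with $P$ a set of $v$ points and $\mathcal{B}$ a collection of $k$-subsets of $P$ such that every two distinct points lie in exactly $\lambda$ blocks. $K_n-H$ is obtained from $K_n$ by removing the edges (not the vertices) of $H$; $\overline{H}$ is the complement of $H$ on its $m$ vertices. A clique partition of a graph $G$ is a family of cliques of $G$ such that the endpoints of every edge lie together in exactly one member; $\operatorname{scp}(G)$ is the minimum of the sum of the sizes of the cliques over all clique partitions of $G$. -}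

module Defs where

open import Level using (0ℓ)
open import Data.Nat using (ℕ)
open import Data.Fin using (Fin)
open import Data.Fin.Subset using (Subset; _∈_; ∣_∣)
open import Data.Fin.Subset.Properties using (_∈?_)
open import Data.List using (List; length; filter; map)
open import Data.Nat.ListAction using (sum)
open import Data.List.Relation.Unary.All using (All)
open import Data.Product using (_×_; ∃; ∃₂; _,_)
open import Relation.Nullary using (¬_)
open import Relation.Nullary.Decidable using (_×-dec_)
open import Relation.Binary.PropositionalEquality using (_≡_; _≢_)
open import Function.Definitions using (Injective)

record Graph (n : ℕ) : Set₁ where
  field
    Adj    : Fin n → Fin n → Set
    sym    : ∀ {u v} → Adj u v → Adj v u
    irrefl : ∀ {u} → ¬ Adj u u
open Graph public

countBoth : ∀ {n} → Fin n → Fin n → List (Subset n) → ℕ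
countBoth x y Bs = length (filter (λ B → (x ∈? B) ×-dec (y ∈? B)) Bs)

-- A (v,k,λ)-design with point set Fin v and block collection Bs
-- (a list, so repeated blocks are allowed).
IsDesign : (v k λ' : ℕ) → List (Subset v) → Set
IsDesign v k λ' Bs =
  All (λ B → ∣ B ∣ ≡ k) Bs × (∀ x y → x ≢ y → countBoth x y Bs ≡ λ')

DesignExists : (v k λ' : ℕ) → Set
DesignExists v k λ' = ∃ λ (Bs : List (Subset v)) → IsDesign v k λ' Bs

IsClique : ∀ {n} → Graph n → Subset n → Set
IsClique G C = ∀ x y → x ∈ C → y ∈ C → x ≢ y → Adj G x y

IsCliquePartition : ∀ {n} → Graph n → List (Subset n) → Set
IsCliquePartition G Cs =
  All (IsClique G) Cs × (∀ x y → Adj G x y → countBoth x y Cs ≡ 1)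

cpSize : ∀ {n} → List (Subset n) → ℕ
cpSize Cs = sum (map ∣_∣ Cs)

IsScp : ∀ {n} → Graph n → ℕ → Set
IsScp G s =
  (∃ λ Cs → IsCliquePartition G Cs × cpSize Cs ≡ s)
  × (∀ Cs → IsCliquePartition G Cs → s Data.Nat.≤ cpSize Cs)

complement : ∀ {m} → Graph m → Graph m
complement H = record
  { Adj    = λ a b → a ≢ b × ¬ Adj H a b
  ; sym    = λ { (a≢b , ¬h) → (λ e → a≢b (Relation.Binary.PropositionalEquality.sym e))
                            , (λ h → ¬h (Graph.sym H h)) }
  ; irrefl = λ { (a≢a , _) → a≢a Relation.Binary.PropositionalEquality.refl }
  }

-- K_n − H, where H sits on the vertices f(0),…,f(m−1) of K_n (f injective):
-- remove the edges f(a)f(b) with ab an edge of H.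
KnMinus : ∀ {m} n → (H : Graph m) → (f : Fin m → Fin n) → Graph n
KnMinus n H f = record
  { Adj    = λ u v → u ≢ v × ¬ (∃₂ λ a b → f a ≡ u × f b ≡ v × Adj H a b)
  ; sym    = λ { (u≢v , ¬e) → (λ e → u≢v (Relation.Binary.PropositionalEquality.sym e))
                            , (λ { (a , b , fa , fb , h) → ¬e (b , a , fb , fa , Graph.sym H h) }) }
  ; irrefl = λ { (u≢u , _) → u≢u Relation.Binary.PropositionalEquality.refl }
  }

-- Fix a block B₀ of the design and embed the n vertices of K_n injectively into its
-- points so that exactly the m vertices of H land in B₀; this is possible because
-- m ≤ k and n − m ≤ v − k. The pull-backs of the other blocks are cliques of K_n − H,
-- since two vertices of H already lie together in B₀ and hence in no other block, and
-- they cover every remaining pair exactly once; the pairs of vertices of H that are not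
-- edges of H are covered by the image of a clique partition of H̄. Every point lies on
-- r = (v − 1)/(k − 1) blocks, so the pull-backs have total size n r − m, whence
-- scp(K_n − H) ≤ n r − m + scp(H̄).

module Submission where

open import Defs hiding (sym)
open import Data.Bool using (Bool; true; false; _∧_)
open import Data.Bool.Properties using () renaming (_≟_ to _≟ᵇ_)
open import Data.Empty using (⊥-elim)
open import Data.Fin using (Fin; zero; suc; punchIn; punchOut)
open import Data.Fin.Properties
  using (any?; injective⇒≤; punchInᵢ≢i; punchIn-injective; punchOut-injective; punchIn-punchOut; 0≢1+n)
  renaming (_≟_ to _≟ᶠ_; suc-injective to Fin-suc-injective)
open import Data.Fin.Subset using (Subset; _∈_; ⊤; ∣_∣)
open import Data.Fin.Subset.Properties using (_∈?_)
open import Data.List using (List; []; _∷_; map; _++_; length; filter)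
open import Data.List.Membership.Propositional using () renaming (_∈_ to _∈ₗ_)
open import Data.List.Properties using (map-++; map-∘; map-cong; map-cong-local; filter-++; length-++)
open import Data.List.Relation.Unary.All as All using (All; _∷_)
open import Data.List.Relation.Unary.All.Properties using (map⁺; ++⁺)
open import Data.List.Relation.Unary.Any using (here; there)
open import Data.Nat using (ℕ; zero; suc; _+_; _*_; _∸_; _≤_; _<_; z≤n; s≤s)
open import Data.Nat.ListAction using (sum)
open import Data.Nat.ListAction.Properties using (sum-++)
open import Data.Nat.Properties
  using (+-*-semiring; +-assoc; +-comm; *-comm; *-identityˡ; *-identityʳ; *-zeroʳ; *-distribʳ-+;
         +-cancelˡ-≤; +-cancelʳ-≤; +-mono-≤; +-monoˡ-≤; *-monoˡ-≤; ≤-trans; ≤-reflexive;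
         m≤m+n; m≤n+m; 1+n≰n; m≤n⇒m∸n≡0; suc-injective; module ≤-Reasoning)
open import Algebra.Properties.Semiring.Sum +-*-semiring
  using (sum-syntax; sum-cong-≗; sum-remove; sum-replicate-zero; ∑-distrib-+; *-distribˡ-sum; *-distribʳ-sum)
open import Data.Product using (_×_; ∃; _,_; proj₂)
open import Data.Sum using (_⊎_; inj₁; inj₂)
open import Data.Vec using ([]; _∷_; lookup; tabulate)
open import Data.Vec.Properties using (lookup∘tabulate; lookup-replicate; []=⇒lookup; lookup⇒[]=)
open import Function using (_∘_)
open import Function.Definitions using (Injective)
open import Relation.Binary.Definitions using (DecidableEquality)
open import Relation.Binary.PropositionalEquality
open import Relation.Nullary using (¬_; Dec; yes; no; does; contradiction)
open import Relation.Nullary.Decidable using (_×-dec_; dec-true; dec-false)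
open import Relation.Unary using (Decidable)

χ : Bool → ℕ
χ true  = 1
χ false = 0

χ-∧ : ∀ a b → χ (a ∧ b) ≡ χ a * χ b
χ-∧ true  b = sym (*-identityˡ (χ b))
χ-∧ false b = refl

∑-const : ∀ n c → ∑[ i < n ] c ≡ n * c
∑-const zero    c = refl
∑-const (suc n) c = cong (c +_) (∑-const n c)

∑χ-positive : ∀ {n} {P : Fin n → Set} (P? : Decidable P) → 0 < ∑[ i < n ] χ (does (P? i)) → ∃ P
∑χ-positive {suc n} P? pos with P? zero
... | yes p = zero , p
... | no _  with ∑χ-positive (P? ∘ suc) pos
...   | i , p = suc i , p

∑-reindex : ∀ {m n} (f : Fin m → Fin n) → Injective _≡_ _≡_ f → (w : Fin n → ℕ) →
  (∀ u → (∀ a → f a ≢ u) → w u ≡ 0) → ∑[ u < n ] w u ≡ ∑[ a < m ] w (f a)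
∑-reindex {zero}  {n}     f _ w w-off = trans (sum-cong-≗ (λ u → w-off u λ ())) (sum-replicate-zero n)
∑-reindex {suc m} {zero}  f _ _ _ with f zero
... | ()
∑-reindex {suc m} {suc n} f f-inj w w-off = begin
  ∑[ u < suc n ] w u
    ≡⟨ sum-remove {i = f zero} w ⟩
  w (f zero) + ∑[ u < n ] w (punchIn (f zero) u)
    ≡⟨ cong (w (f zero) +_) (∑-reindex f′ f′-inj _ w′-off) ⟩
  w (f zero) + ∑[ a < m ] w (punchIn (f zero) (f′ a))
    ≡⟨ cong (w (f zero) +_) (sum-cong-≗ (cong w ∘ punchIn-punchOut ∘ f₀≢f₊)) ⟩
  ∑[ a < suc m ] w (f a) ∎
  where
  open ≡-Reasoning
  f₀≢f₊ : ∀ a → f zero ≢ f (suc a)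
  f₀≢f₊ a = 0≢1+n ∘ f-inj
  f′ : Fin m → Fin n
  f′ a = punchOut (f₀≢f₊ a)
  f′-inj : Injective _≡_ _≡_ f′
  f′-inj e = Fin-suc-injective (f-inj (punchOut-injective (f₀≢f₊ _) (f₀≢f₊ _) e))
  w′-off : ∀ u → (∀ a → f′ a ≢ u) → w (punchIn (f zero) u) ≡ 0
  w′-off u u∉f′ = w-off _ λ
    { zero    e → punchInᵢ≢i (f zero) u (sym e)
    ; (suc a) e → u∉f′ a (punchIn-injective (f zero) _ _ (trans (punchIn-punchOut (f₀≢f₊ a)) e))
    }

sum-map-*ʳ : ∀ {A : Set} (h : A → ℕ) c (L : List A) → sum (map h L) * c ≡ sum (map (λ x → h x * c) L)
sum-map-*ʳ h c []      = refl
sum-map-*ʳ h c (x ∷ L) = trans (*-distribʳ-+ c (h x) _) (cong (h x * c +_) (sum-map-*ʳ h c L))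

sum-map-∑ : ∀ {A : Set} n (h : A → Fin n → ℕ) (L : List A) →
  sum (map (λ x → ∑[ i < n ] h x i) L) ≡ ∑[ i < n ] sum (map (λ x → h x i) L)
sum-map-∑ n h []      = sym (sum-replicate-zero n)
sum-map-∑ n h (x ∷ L) = trans (cong (∑[ i < n ] h x i +_) (sum-map-∑ n h L)) (sym (∑-distrib-+ (h x) _))

inc : ∀ {n} → Fin n → Subset n → ℕ
inc x B = χ (lookup B x)

∣p∣≡∑inc : ∀ {n} (p : Subset n) → ∣ p ∣ ≡ ∑[ x < n ] inc x p
∣p∣≡∑inc []          = refl
∣p∣≡∑inc (true  ∷ p) = cong suc (∣p∣≡∑inc p)
∣p∣≡∑inc (false ∷ p) = ∣p∣≡∑inc p

∣⊤∣≡n : ∀ n → ∣ ⊤ {n} ∣ ≡ n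
∣⊤∣≡n zero    = refl
∣⊤∣≡n (suc n) = cong suc (∣⊤∣≡n n)

does-∈? : ∀ {n} (x : Fin n) (p : Subset n) → does (x ∈? p) ≡ lookup p x
does-∈? zero    (true  ∷ p) = refl
does-∈? zero    (false ∷ p) = refl
does-∈? (suc x) (b ∷ p)     = does-∈? x p

length-filter-∷ : ∀ {A : Set} {P : A → Set} (P? : Decidable P) x (L : List A) →
  length (filter P? (x ∷ L)) ≡ χ (does (P? x)) + length (filter P? L)
length-filter-∷ P? x L with does (P? x)
... | true  = refl
... | false = refl

countBoth-∷ : ∀ {n} (x y : Fin n) B (L : List (Subset n)) →
  countBoth x y (B ∷ L) ≡ inc x B * inc y B + countBoth x y L
countBoth-∷ x y B L = begin
  countBoth x y (B ∷ L)
    ≡⟨ length-filter-∷ _ B L ⟩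
  χ (does (x ∈? B) ∧ does (y ∈? B)) + countBoth x y L
    ≡⟨ cong (_+ countBoth x y L) (χ-∧ (does (x ∈? B)) _) ⟩
  χ (does (x ∈? B)) * χ (does (y ∈? B)) + countBoth x y L
    ≡⟨ cong₂ (λ a b → χ a * χ b + countBoth x y L) (does-∈? x B) (does-∈? y B) ⟩
  inc x B * inc y B + countBoth x y L ∎
  where open ≡-Reasoning

countBoth≡sum : ∀ {n} (x y : Fin n) (L : List (Subset n)) → countBoth x y L ≡ sum (map (λ B → inc x B * inc y B) L)
countBoth≡sum x y []      = refl
countBoth≡sum x y (B ∷ L) = trans (countBoth-∷ x y B L) (cong (inc x B * inc y B +_) (countBoth≡sum x y L))

countBoth-++ : ∀ {n} (x y : Fin n) (L L′ : List (Subset n)) → countBoth x y (L ++ L′) ≡ countBoth x y L + countBoth x y L′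
countBoth-++ x y L L′ =
  trans (cong length (filter-++ (λ B → (x ∈? B) ×-dec (y ∈? B)) L L′)) (length-++ (filter _ L))

countBoth-∈ : ∀ {n} (x y : Fin n) {B} {L : List (Subset n)} → B ∈ₗ L → inc x B * inc y B ≤ countBoth x y L
countBoth-∈ x y {L = B ∷ L} (here refl) =
  ≤-trans (m≤m+n _ _) (≤-reflexive (sym (countBoth-∷ x y B L)))
countBoth-∈ x y {L = B ∷ L} (there B′∈L) =
  ≤-trans (countBoth-∈ x y B′∈L) (≤-trans (m≤n+m _ _) (≤-reflexive (sym (countBoth-∷ x y B L))))

replication : ∀ {v} → Fin v → List (Subset v) → ℕ
replication x Bs = sum (map (inc x) Bs)

inc*[∣B∣∸1] : ∀ {v} (x : Fin (suc v)) B → inc x B * (∣ B ∣ ∸ 1) ≡ ∑[ y < v ] (inc x B * inc (punchIn x y) B)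
inc*[∣B∣∸1] {v} x B = begin
  inc x B * (∣ B ∣ ∸ 1)
    ≡⟨ cong (λ s → inc x B * (s ∸ 1)) (trans (∣p∣≡∑inc B) (sum-remove {i = x} (λ z → inc z B))) ⟩
  inc x B * (inc x B + ∑[ y < v ] inc (punchIn x y) B ∸ 1)
    ≡⟨ drop-self (lookup B x) (∑[ y < v ] inc (punchIn x y) B) ⟩
  inc x B * ∑[ y < v ] inc (punchIn x y) B
    ≡⟨ *-distribˡ-sum (inc x B) (λ y → inc (punchIn x y) B) ⟩
  ∑[ y < v ] (inc x B * inc (punchIn x y) B) ∎
  where
  open ≡-Reasoning
  drop-self : ∀ b s → χ b * (χ b + s ∸ 1) ≡ χ b * s
  drop-self true  s = refl
  drop-self false s = refl

replication-design : ∀ {v k λ' Bs} → IsDesign v k λ' Bs → ∀ x → replication x Bs * (k ∸ 1) ≡ λ' * (v ∸ 1)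
replication-design {suc v} {k} {λ'} {Bs} (sizes , pairs) x = begin
  replication x Bs * (k ∸ 1)
    ≡⟨ sum-map-*ʳ (inc x) (k ∸ 1) Bs ⟩
  sum (map (λ B → inc x B * (k ∸ 1)) Bs)
    ≡⟨ cong sum (map-cong-local (All.map (λ {B} ∣B∣≡k → cong (λ s → inc x B * (s ∸ 1)) (sym ∣B∣≡k)) sizes)) ⟩
  sum (map (λ B → inc x B * (∣ B ∣ ∸ 1)) Bs)
    ≡⟨ cong sum (map-cong (inc*[∣B∣∸1] x) Bs) ⟩
  sum (map (λ B → ∑[ y < v ] (inc x B * inc (punchIn x y) B)) Bs)
    ≡⟨ sum-map-∑ v _ Bs ⟩
  ∑[ y < v ] sum (map (λ B → inc x B * inc (punchIn x y) B) Bs)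
    ≡⟨ sum-cong-≗ (λ y → trans (sym (countBoth≡sum x _ Bs)) (pairs x (punchIn x y) (punchInᵢ≢i x y ∘ sym))) ⟩
  ∑[ y < v ] λ'
    ≡⟨ ∑-const v λ' ⟩
  v * λ'
    ≡⟨ *-comm v λ' ⟩
  λ' * v ∎
  where open ≡-Reasoning

module _ {A : Set} (_≟_ : DecidableEquality A) where

  fibreSize : ∀ {n} → (Fin n → A) → A → ℕ
  fibreSize {n} c a = ∑[ i < n ] χ (does (c i ≟ a))

  fibreSize-punchIn : ∀ {n v} (S : Fin (suc n) → A) (T : Fin (suc v) → A) t → T t ≡ S zero →
    ∀ a → fibreSize S a ≤ fibreSize T a → fibreSize (S ∘ suc) a ≤ fibreSize (T ∘ punchIn t) a
  fibreSize-punchIn S T t Tt≡S₀ a S≤T = +-cancelˡ-≤ (χ (does (S zero ≟ a))) _ _ (begin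
    fibreSize S a
      ≤⟨ S≤T ⟩
    fibreSize T a
      ≡⟨ sum-remove {i = t} (λ i → χ (does (T i ≟ a))) ⟩
    χ (does (T t ≟ a)) + fibreSize (T ∘ punchIn t) a
      ≡⟨ cong (λ b → χ (does (b ≟ a)) + fibreSize (T ∘ punchIn t) a) Tt≡S₀ ⟩
    χ (does (S zero ≟ a)) + fibreSize (T ∘ punchIn t) a ∎)
    where open ≤-Reasoning

  fibreSize-head : ∀ {n} (S : Fin (suc n) → A) → 0 < fibreSize S (S zero)
  fibreSize-head S = subst (λ b → 0 < χ b + fibreSize (S ∘ suc) (S zero)) (sym (dec-true (S zero ≟ S zero) refl)) (s≤s z≤n)

  fibre-preserving-injection : ∀ {n v} (S : Fin n → A) (T : Fin v → A) → (∀ a → fibreSize S a ≤ fibreSize T a) →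
    ∃ λ (g : Fin n → Fin v) → Injective _≡_ _≡_ g × (∀ u → T (g u) ≡ S u)
  fibre-preserving-injection {zero}  S T _ = (λ ()) , (λ { {()} }) , (λ ())
  fibre-preserving-injection {suc n} {zero} S T fits with ≤-trans (fibreSize-head S) (fits (S zero))
  ... | ()
  fibre-preserving-injection {suc n} {suc v} S T fits
    with ∑χ-positive (λ i → T i ≟ S zero) (≤-trans (fibreSize-head S) (fits (S zero)))
  ... | t , Tt≡S₀
    with fibre-preserving-injection (S ∘ suc) (T ∘ punchIn t) (λ a → fibreSize-punchIn S T t Tt≡S₀ a (fits a))
  ...   | g′ , g′-inj , g′-fibre = g , g-inj , g-fibre
    where
    g : Fin (suc n) → Fin (suc v)
    g zero    = t
    g (suc u) = punchIn t (g′ u)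
    g-inj : Injective _≡_ _≡_ g
    g-inj {zero}  {zero}  _ = refl
    g-inj {zero}  {suc j} e = ⊥-elim (punchInᵢ≢i t (g′ j) (sym e))
    g-inj {suc i} {zero}  e = ⊥-elim (punchInᵢ≢i t (g′ i) e)
    g-inj {suc i} {suc j} e = cong suc (g′-inj (punchIn-injective t _ _ e))
    g-fibre : ∀ u → T (g u) ≡ S u
    g-fibre zero    = Tt≡S₀
    g-fibre (suc u) = g′-fibre u

pullback : ∀ {n v} → (Fin n → Fin v) → Subset v → Subset n
pullback g B = tabulate (λ u → lookup B (g u))

lookup-pullback : ∀ {n v} (g : Fin n → Fin v) B u → lookup (pullback g B) u ≡ lookup B (g u)
lookup-pullback g B = lookup∘tabulate (λ u → lookup B (g u))

countBoth-pullback : ∀ {n v} (g : Fin n → Fin v) x y (L : List (Subset v)) →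
  countBoth x y (map (pullback g) L) ≡ countBoth (g x) (g y) L
countBoth-pullback g x y []      = refl
countBoth-pullback g x y (B ∷ L) = begin
  countBoth x y (map (pullback g) (B ∷ L))
    ≡⟨ countBoth-∷ x y (pullback g B) _ ⟩
  inc x (pullback g B) * inc y (pullback g B) + countBoth x y (map (pullback g) L)
    ≡⟨ cong₂ (λ a b → χ a * χ b + _) (lookup-pullback g B x) (lookup-pullback g B y) ⟩
  inc (g x) B * inc (g y) B + countBoth x y (map (pullback g) L)
    ≡⟨ cong (inc (g x) B * inc (g y) B +_) (countBoth-pullback g x y L) ⟩
  inc (g x) B * inc (g y) B + countBoth (g x) (g y) L
    ≡⟨ sym (countBoth-∷ (g x) (g y) B L) ⟩
  countBoth (g x) (g y) (B ∷ L) ∎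
  where open ≡-Reasoning

∑∣pullback∣ : ∀ {n v} (g : Fin n → Fin v) (L : List (Subset v)) →
  sum (map ∣_∣ (map (pullback g) L)) ≡ ∑[ u < n ] replication (g u) L
∑∣pullback∣ {n} g L = begin
  sum (map ∣_∣ (map (pullback g) L))               ≡⟨ cong sum (sym (map-∘ L)) ⟩
  sum (map (λ B → ∣ pullback g B ∣) L)             ≡⟨ cong sum (map-cong ∣pullback∣ L) ⟩
  sum (map (λ B → ∑[ u < n ] inc (g u) B) L)       ≡⟨ sum-map-∑ n (λ B u → inc (g u) B) L ⟩
  ∑[ u < n ] replication (g u) L                   ∎
  where
  open ≡-Reasoning
  ∣pullback∣ : ∀ B → ∣ pullback g B ∣ ≡ ∑[ u < n ] inc (g u) B
  ∣pullback∣ B = trans (∣p∣≡∑inc (pullback g B)) (sum-cong-≗ (cong χ ∘ lookup-pullback g B))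

image? : ∀ {m n} (f : Fin m → Fin n) C u → Dec (∃ λ a → f a ≡ u × a ∈ C)
image? f C u = any? (λ a → (f a ≟ᶠ u) ×-dec (a ∈? C))

image : ∀ {m n} → (Fin m → Fin n) → Subset m → Subset n
image f C = tabulate (does ∘ image? f C)

image-∈ : ∀ {m n} {f : Fin m → Fin n} {C u} → u ∈ image f C → ∃ λ a → f a ≡ u × a ∈ C
image-∈ {f = f} {C} {u} u∈ = witness (image? f C u) (trans (sym (lookup∘tabulate (does ∘ image? f C) u)) ([]=⇒lookup u∈))
  where
  witness : ∀ {P : Set} (P? : Dec P) → does P? ≡ true → P
  witness (yes p) _ = p

lookup-image-∉ : ∀ {m n} {f : Fin m → Fin n} C {u} → (∀ a → f a ≢ u) → lookup (image f C) u ≡ false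
lookup-image-∉ {f = f} C {u} u∉f =
  trans (lookup∘tabulate (does ∘ image? f C) u) (dec-false (image? f C u) λ (a , fa≡u , _) → u∉f a fa≡u)

countBoth-image-∉ : ∀ {m n} {f : Fin m → Fin n} {x y} → (∀ a → f a ≢ x) ⊎ (∀ a → f a ≢ y) →
  ∀ (L : List (Subset m)) → countBoth x y (map (image f) L) ≡ 0
countBoth-image-∉                   off []      = refl
countBoth-image-∉ {f = f} {x} {y} off (C ∷ L) =
  trans (countBoth-∷ x y (image f C) _) (cong₂ _+_ (no-pair off) (countBoth-image-∉ off L))
  where
  no-pair : (∀ a → f a ≢ x) ⊎ (∀ a → f a ≢ y) → inc x (image f C) * inc y (image f C) ≡ 0
  no-pair (inj₁ x∉f) = cong (λ p → χ p * inc y (image f C)) (lookup-image-∉ C x∉f)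
  no-pair (inj₂ y∉f) = trans (cong (λ p → inc x (image f C) * χ p) (lookup-image-∉ C y∉f)) (*-zeroʳ (inc x (image f C)))

module _ {m n} {f : Fin m → Fin n} (f-inj : Injective _≡_ _≡_ f) where

  lookup-image : ∀ C a → lookup (image f C) (f a) ≡ lookup C a
  lookup-image C a = trans (lookup∘tabulate (does ∘ image? f C) (f a)) (decide (lookup C a) refl)
    where
    decide : ∀ b → lookup C a ≡ b → does (image? f C (f a)) ≡ b
    decide true  C[a] = dec-true (image? f C (f a)) (a , refl , lookup⇒[]= a C C[a])
    decide false C[a] = dec-false (image? f C (f a)) λ (a′ , fa′≡fa , a′∈C) →
      contradiction (trans (sym (subst (λ z → lookup C z ≡ true) (f-inj fa′≡fa) ([]=⇒lookup a′∈C))) C[a]) λ ()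

  ∣image∣ : ∀ C → ∣ image f C ∣ ≡ ∣ C ∣
  ∣image∣ C = begin
    ∣ image f C ∣                       ≡⟨ ∣p∣≡∑inc (image f C) ⟩
    ∑[ u < n ] inc u (image f C)        ≡⟨ ∑-reindex f f-inj _ (λ u u∉f → cong χ (lookup-image-∉ C u∉f)) ⟩
    ∑[ a < m ] inc (f a) (image f C)    ≡⟨ sum-cong-≗ (cong χ ∘ lookup-image C) ⟩
    ∑[ a < m ] inc a C                  ≡⟨ sym (∣p∣≡∑inc C) ⟩
    ∣ C ∣                               ∎
    where open ≡-Reasoning

  countBoth-image : ∀ a b (L : List (Subset m)) → countBoth (f a) (f b) (map (image f) L) ≡ countBoth a b L
  countBoth-image a b []      = refl
  countBoth-image a b (C ∷ L) = begin
    countBoth (f a) (f b) (map (image f) (C ∷ L))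
      ≡⟨ countBoth-∷ (f a) (f b) (image f C) _ ⟩
    inc (f a) (image f C) * inc (f b) (image f C) + countBoth (f a) (f b) (map (image f) L)
      ≡⟨ cong₂ (λ p q → χ p * χ q + _) (lookup-image C a) (lookup-image C b) ⟩
    inc a C * inc b C + countBoth (f a) (f b) (map (image f) L)
      ≡⟨ cong (inc a C * inc b C +_) (countBoth-image a b L) ⟩
    inc a C * inc b C + countBoth a b L
      ≡⟨ sym (countBoth-∷ a b C L) ⟩
    countBoth a b (C ∷ L) ∎
    where open ≡-Reasoning

fibreSize-true : ∀ {n} (p : Subset n) → fibreSize _≟ᵇ_ (lookup p) true ≡ ∣ p ∣
fibreSize-true p = trans (sum-cong-≗ (λ i → χ-≟true (lookup p i))) (sym (∣p∣≡∑inc p))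
  where
  χ-≟true : ∀ b → χ (does (b ≟ᵇ true)) ≡ χ b
  χ-≟true true  = refl
  χ-≟true false = refl

fibreSize-false+true : ∀ {n} (c : Fin n → Bool) → fibreSize _≟ᵇ_ c false + fibreSize _≟ᵇ_ c true ≡ n
fibreSize-false+true {n} c = begin
  fibreSize _≟ᵇ_ c false + fibreSize _≟ᵇ_ c true
    ≡⟨ sym (∑-distrib-+ (λ i → χ (does (c i ≟ᵇ false))) (λ i → χ (does (c i ≟ᵇ true)))) ⟩
  ∑[ i < n ] (χ (does (c i ≟ᵇ false)) + χ (does (c i ≟ᵇ true)))
    ≡⟨ sum-cong-≗ (one-fibre ∘ c) ⟩
  ∑[ i < n ] 1
    ≡⟨ ∑-const n 1 ⟩
  n * 1
    ≡⟨ *-identityʳ n ⟩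
  n ∎
  where
  open ≡-Reasoning
  one-fibre : ∀ b → χ (does (b ≟ᵇ false)) + χ (does (b ≟ᵇ true)) ≡ 1
  one-fibre true  = refl
  one-fibre false = refl

complement-≤ : ∀ {a b m n k v} → a + m ≡ n → b + k ≡ v → n + k ≤ v + m → a ≤ b
complement-≤ {a} {b} {m} {k = k} refl refl n+k≤v+m = +-cancelʳ-≤ (m + k) a b (begin
  a + (m + k)   ≡⟨ sym (+-assoc a m k) ⟩
  a + m + k     ≤⟨ n+k≤v+m ⟩
  b + k + m     ≡⟨ +-assoc b k m ⟩
  b + (k + m)   ≡⟨ cong (b +_) (+-comm k m) ⟩
  b + (m + k)   ∎)
  where open ≤-Reasoning

embedding-into-block : ∀ {m n v k} (f : Fin m → Fin n) → Injective _≡_ _≡_ f → (B₀ : Subset v) → ∣ B₀ ∣ ≡ k →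
  m ≤ k → n + k ≤ v + m →
  ∃ λ (g : Fin n → Fin v) → Injective _≡_ _≡_ g × (∀ u → lookup B₀ (g u) ≡ lookup (image f ⊤) u)
embedding-into-block {m} {n} {v} {k} f f-inj B₀ ∣B₀∣≡k m≤k n+k≤v+m =
  fibre-preserving-injection _≟ᵇ_ S T fits
  where
  S : Fin n → Bool
  S = lookup (image f ⊤)
  T : Fin v → Bool
  T = lookup B₀
  S-true : fibreSize _≟ᵇ_ S true ≡ m
  S-true = trans (fibreSize-true (image f ⊤)) (trans (∣image∣ f-inj ⊤) (∣⊤∣≡n m))
  T-true : fibreSize _≟ᵇ_ T true ≡ k
  T-true = trans (fibreSize-true B₀) ∣B₀∣≡k
  fits : ∀ b → fibreSize _≟ᵇ_ S b ≤ fibreSize _≟ᵇ_ T b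
  fits true  = subst₂ _≤_ (sym S-true) (sym T-true) m≤k
  fits false = complement-≤
    (subst (λ s → fibreSize _≟ᵇ_ S false + s ≡ n) S-true (fibreSize-false+true S))
    (subst (λ s → fibreSize _≟ᵇ_ T false + s ≡ v) T-true (fibreSize-false+true T))
    n+k≤v+m

module KnMinusPartition {m n v} (H : Graph m) {f : Fin m → Fin n} (f-inj : Injective _≡_ _≡_ f)
  (B₀ : Subset v) (Bs : List (Subset v)) (linear : ∀ x y → x ≢ y → countBoth x y (B₀ ∷ Bs) ≡ 1)
  {g : Fin n → Fin v} (g-inj : Injective _≡_ _≡_ g) (g-B₀ : ∀ u → lookup B₀ (g u) ≡ lookup (image f ⊤) u)
  where

  partitionFrom : List (Subset m) → List (Subset n)
  partitionFrom Cs = map (pullback g) Bs ++ map (image f) Cs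

  pulledBackSize : ℕ
  pulledBackSize = sum (map ∣_∣ (map (pullback g) Bs))

  private
    V[H] : Subset n
    V[H] = image f ⊤

    inc-V[H] : ∀ a → inc (f a) V[H] ≡ 1
    inc-V[H] a = cong χ (trans (lookup-image f-inj ⊤ a) (lookup-replicate a true))

    inc-V[H]-∉ : ∀ {u} → ¬ (∃ λ a → f a ≡ u) → inc u V[H] ≡ 0
    inc-V[H]-∉ u∉f = cong χ (lookup-image-∉ ⊤ λ a e → u∉f (a , e))

    B₀-count : ∀ x y → x ≢ y → inc x V[H] * inc y V[H] + countBoth (g x) (g y) Bs ≡ 1
    B₀-count x y x≢y = begin
      inc x V[H] * inc y V[H] + countBoth (g x) (g y) Bs
        ≡⟨ cong₂ (λ p q → χ p * χ q + countBoth (g x) (g y) Bs) (sym (g-B₀ x)) (sym (g-B₀ y)) ⟩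
      inc (g x) B₀ * inc (g y) B₀ + countBoth (g x) (g y) Bs
        ≡⟨ sym (countBoth-∷ (g x) (g y) B₀ Bs) ⟩
      countBoth (g x) (g y) (B₀ ∷ Bs)
        ≡⟨ linear (g x) (g y) (x≢y ∘ g-inj) ⟩
      1 ∎
      where open ≡-Reasoning

    covered-only-by-B₀ : ∀ a b → f a ≢ f b → countBoth (g (f a)) (g (f b)) Bs ≡ 0
    covered-only-by-B₀ a b fa≢fb = suc-injective (trans
      (cong₂ (λ p q → p * q + countBoth (g (f a)) (g (f b)) Bs) (sym (inc-V[H] a)) (sym (inc-V[H] b)))
      (B₀-count (f a) (f b) fa≢fb))

    covered-outside-B₀ : ∀ x y → x ≢ y → inc x V[H] * inc y V[H] ≡ 0 → countBoth (g x) (g y) Bs ≡ 1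
    covered-outside-B₀ x y x≢y not-both = trans (cong (_+ countBoth (g x) (g y) Bs) (sym not-both)) (B₀-count x y x≢y)

  pullback-clique : ∀ {B} → B ∈ₗ Bs → IsClique (KnMinus n H f) (pullback g B)
  pullback-clique {B} B∈Bs x y x∈B y∈B x≢y = x≢y , λ { (a , b , refl , refl , _) → 1+n≰n (begin
    1                                   ≡⟨ sym (cong₂ _*_ (in-B x∈B) (in-B y∈B)) ⟩
    inc (g (f a)) B * inc (g (f b)) B   ≤⟨ countBoth-∈ (g (f a)) (g (f b)) B∈Bs ⟩
    countBoth (g (f a)) (g (f b)) Bs    ≡⟨ covered-only-by-B₀ a b x≢y ⟩
    0                                   ∎) }
    where
    open ≤-Reasoning
    in-B : ∀ {u} → u ∈ pullback g B → inc (g u) B ≡ 1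
    in-B {u} u∈B = cong χ (trans (sym (lookup-pullback g B u)) ([]=⇒lookup u∈B))

  image-clique : ∀ {C} → IsClique (complement H) C → IsClique (KnMinus n H f) (image f C)
  image-clique C-clique x y x∈ y∈ x≢y with image-∈ {f = f} x∈ | image-∈ {f = f} y∈
  ... | a , refl , a∈C | b , refl , b∈C = x≢y , λ { (a′ , b′ , fa′≡fa , fb′≡fb , H-edge) →
    proj₂ (C-clique a b a∈C b∈C (x≢y ∘ cong f)) (subst₂ (Adj H) (f-inj fa′≡fa) (f-inj fb′≡fb) H-edge) }

  countBoth-partitionFrom : ∀ Cs x y →
    countBoth x y (partitionFrom Cs) ≡ countBoth (g x) (g y) Bs + countBoth x y (map (image f) Cs)
  countBoth-partitionFrom Cs x y =
    trans (countBoth-++ x y (map (pullback g) Bs) _) (cong (_+ _) (countBoth-pullback g x y Bs))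

  covers : ∀ {Cs} → (∀ a b → Adj (complement H) a b → countBoth a b Cs ≡ 1) →
    ∀ x y → Adj (KnMinus n H f) x y → countBoth x y (partitionFrom Cs) ≡ 1
  covers {Cs} Cs-covers x y (x≢y , ¬H-edge) with any? (λ a → f a ≟ᶠ x) | any? (λ b → f b ≟ᶠ y)
  ... | yes (a , refl) | yes (b , refl) = trans (countBoth-partitionFrom Cs x y) (cong₂ _+_
        (covered-only-by-B₀ a b x≢y)
        (trans (countBoth-image f-inj a b Cs) (Cs-covers a b ((x≢y ∘ cong f) , λ h → ¬H-edge (a , b , refl , refl , h)))))
  ... | no x∉f | _ = trans (countBoth-partitionFrom Cs x y) (cong₂ _+_
        (covered-outside-B₀ x y x≢y (cong (_* inc y V[H]) (inc-V[H]-∉ x∉f)))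
        (countBoth-image-∉ (inj₁ λ a e → x∉f (a , e)) Cs))
  ... | yes _ | no y∉f = trans (countBoth-partitionFrom Cs x y) (cong₂ _+_
        (covered-outside-B₀ x y x≢y (trans (cong (inc x V[H] *_) (inc-V[H]-∉ y∉f)) (*-zeroʳ (inc x V[H]))))
        (countBoth-image-∉ (inj₂ λ a e → y∉f (a , e)) Cs))

  partitionFrom-isCliquePartition : ∀ {Cs} → IsCliquePartition (complement H) Cs →
    IsCliquePartition (KnMinus n H f) (partitionFrom Cs)
  partitionFrom-isCliquePartition (Cs-cliques , Cs-covers) =
    ++⁺ (map⁺ (All.tabulate pullback-clique)) (map⁺ (All.map image-clique Cs-cliques)) , covers Cs-covers

  cpSize-partitionFrom : ∀ Cs → cpSize (partitionFrom Cs) ≡ pulledBackSize + cpSize Cs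
  cpSize-partitionFrom Cs = begin
    cpSize (partitionFrom Cs)
      ≡⟨ cong sum (map-++ ∣_∣ (map (pullback g) Bs) (map (image f) Cs)) ⟩
    sum (map ∣_∣ (map (pullback g) Bs) ++ map ∣_∣ (map (image f) Cs))
      ≡⟨ sum-++ (map ∣_∣ (map (pullback g) Bs)) _ ⟩
    pulledBackSize + sum (map ∣_∣ (map (image f) Cs))
      ≡⟨ cong (pulledBackSize +_) (cong sum (trans (sym (map-∘ Cs)) (map-cong (∣image∣ f-inj) Cs))) ⟩
    pulledBackSize + cpSize Cs ∎
    where open ≡-Reasoning

  m+pulledBackSize≡n·r : ∀ {k} → All (λ B → ∣ B ∣ ≡ k) (B₀ ∷ Bs) → (m + pulledBackSize) * (k ∸ 1) ≡ n * (v ∸ 1)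
  m+pulledBackSize≡n·r {k} sizes = begin
    (m + pulledBackSize) * (k ∸ 1)
      ≡⟨ cong (λ s → (s + pulledBackSize) * (k ∸ 1)) (sym ∣pullback-B₀∣) ⟩
    sum (map ∣_∣ (map (pullback g) (B₀ ∷ Bs))) * (k ∸ 1)
      ≡⟨ cong (_* (k ∸ 1)) (∑∣pullback∣ g (B₀ ∷ Bs)) ⟩
    (∑[ u < n ] replication (g u) (B₀ ∷ Bs)) * (k ∸ 1)
      ≡⟨ *-distribʳ-sum (k ∸ 1) (λ u → replication (g u) (B₀ ∷ Bs)) ⟩
    ∑[ u < n ] (replication (g u) (B₀ ∷ Bs) * (k ∸ 1))
      ≡⟨ sum-cong-≗ (replication-design (sizes , linear) ∘ g) ⟩
    ∑[ u < n ] (1 * (v ∸ 1))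
      ≡⟨ ∑-const n (1 * (v ∸ 1)) ⟩
    n * (1 * (v ∸ 1))
      ≡⟨ cong (n *_) (*-identityˡ (v ∸ 1)) ⟩
    n * (v ∸ 1) ∎
    where
    open ≡-Reasoning
    ∣pullback-B₀∣ : ∣ pullback g B₀ ∣ ≡ m
    ∣pullback-B₀∣ = begin
      ∣ pullback g B₀ ∣
        ≡⟨ ∣p∣≡∑inc (pullback g B₀) ⟩
      ∑[ u < n ] inc u (pullback g B₀)
        ≡⟨ sum-cong-≗ (λ u → cong χ (trans (lookup-pullback g B₀ u) (g-B₀ u))) ⟩
      ∑[ u < n ] inc u V[H]
        ≡⟨ sym (∣p∣≡∑inc V[H]) ⟩
      ∣ V[H] ∣
        ≡⟨ ∣image∣ f-inj ⊤ ⟩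
      ∣ ⊤ {m} ∣
        ≡⟨ ∣⊤∣≡n m ⟩
      m ∎

no-blocks⇒v≤1 : ∀ {v} → (∀ (x y : Fin v) → x ≢ y → countBoth x y [] ≡ 1) → v ≤ 1
no-blocks⇒v≤1 {zero}        _      = z≤n
no-blocks⇒v≤1 {suc zero}    _      = s≤s z≤n
no-blocks⇒v≤1 {suc (suc v)} linear with linear zero (suc zero) (λ ())
... | ()

mainTheorem9 : (n m : ℕ) (H : Graph m) (f : Fin m → Fin n) → Injective _≡_ _≡_ f →
    (v k : ℕ) → DesignExists v k 1 → m ≤ k → n + k ≤ v + m →
    (s t : ℕ) → IsScp (KnMinus n H f) s → IsScp (complement H) t →
    (s + m) * (k ∸ 1) ≤ n * (v ∸ 1) + t * (k ∸ 1)
mainTheorem9 n m H f f-inj v k ([] , _ , linear) _ n+k≤v+m s t _ _ =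
  subst (λ K → (s + m) * K ≤ n * (v ∸ 1) + t * K) (sym (m≤n⇒m∸n≡0 k≤1))
    (subst (_≤ n * (v ∸ 1) + t * 0) (sym (*-zeroʳ (s + m))) z≤n)
  where
  k≤1 : k ≤ 1
  k≤1 = +-cancelˡ-≤ n k 1 (begin
    n + k   ≤⟨ n+k≤v+m ⟩
    v + m   ≤⟨ +-mono-≤ (no-blocks⇒v≤1 linear) (injective⇒≤ f-inj) ⟩
    1 + n   ≡⟨ +-comm 1 n ⟩
    n + 1   ∎)
    where open ≤-Reasoning

mainTheorem9 n m H f f-inj v k (B₀ ∷ Bs , sizes@(∣B₀∣≡k ∷ _) , linear) m≤k n+k≤v+m s t
  (_ , s-minimal) ((Cs , Cs-partition , refl) , _) with embedding-into-block f f-inj B₀ ∣B₀∣≡k m≤k n+k≤v+m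
... | g , g-inj , g-B₀ = begin
  (s + m) * K
    ≤⟨ *-monoˡ-≤ K (+-monoˡ-≤ m (s-minimal _ (partitionFrom-isCliquePartition Cs-partition))) ⟩
  (cpSize (partitionFrom Cs) + m) * K
    ≡⟨ cong (λ c → (c + m) * K) (cpSize-partitionFrom Cs) ⟩
  (pulledBackSize + cpSize Cs + m) * K
    ≡⟨ cong (_* K) (+-comm (pulledBackSize + cpSize Cs) m) ⟩
  (m + (pulledBackSize + cpSize Cs)) * K
    ≡⟨ cong (_* K) (sym (+-assoc m pulledBackSize (cpSize Cs))) ⟩
  (m + pulledBackSize + cpSize Cs) * K
    ≡⟨ *-distribʳ-+ K (m + pulledBackSize) (cpSize Cs) ⟩
  (m + pulledBackSize) * K + cpSize Cs * K
    ≡⟨ cong (_+ cpSize Cs * K) (m+pulledBackSize≡n·r sizes) ⟩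
  n * (v ∸ 1) + cpSize Cs * K ∎
  where
  open ≤-Reasoning
  open KnMinusPartition H f-inj B₀ Bs linear g-inj g-B₀
  K : ℕ
  K = k ∸ 1
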